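{- Let $G=(A,O)$ be a Manna-Pnueli game with arena $A=(V,E)$ and objective $O=(\Gamma,\gamma,\varphi)$, where each event of $\Gamma$ occurs in at most one atom of $\varphi$. Let $\Gamma_\mathsf{F}$, $\Gamma_\mathsf{G}$ be the sets of events occurring in atoms $\mathsf{F}\,a$, resp. $\mathsf{G}\,a$, let $\Gamma_{\mathsf{F},\mathsf{G}}=\Gamma_\mathsf{F}\cup\Gamma_\mathsf{G}$, and let $\Gamma_{\mathsf{EL}}$ be the set of remaining (Emerson-Lei) events of $\varphi$. For $v\in V$ and $L\subseteq\Gamma_{\mathsf{F},\mathsf{G}}$ let $\mathsf{upd}(v,L)=((L\cap\gamma(v))\cap\Gamma_\mathsf{G})\cup((L\cup\gamma(v))\cap\Gamma_\mathsf{F})$. Let $A'=(V',E')$ with $V'=V\times 2^{\Gamma_{\mathsf{F},\mathsf{G}}}$, $E'(v,L)=E(v)\times\{\mathsf{upd}(v,L)\}$, where $(v,L)$ is owned by the owner of $v$; let $\gamma'(v,L)=(\gamma(v)\cap\Gamma_{\mathsf{EL}})\cup L$; let $\varphi_1$ be obtained from $\varphi$ by replacing every atom $\mathsf{F}\,a$ or $\mathsf{G}\,a$ by $\mathsf{GF}\,a$; and let $G_1=(A',(\Gamma,\gamma',\varphi_1))$. Then $G$ and $G_1$ are equivalent: for every $v\in V$, the system player wins $v$ in $G$ if and only if the system player wins $(v,\Gamma_\mathsf{G})$ in $G_1$.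
   Context: A game arena $A=(V,E)$ is a finite directed graph with $E(v)\neq\emptyset$ for all $v$, whose nodes are partitioned into system nodes $V_s$ and environment nodes $V_e$. A play is an infinite path; a system strategy maps each finite play ending in $V_s$ to a successor of its last node; a play is compatible with a strategy if all system moves follow it. An MP objective $(\Gamma,\gamma,\varphi)$ on $V$ consists of a finite event set $\Gamma$ (with $|\Gamma|\le|V|$), a labeling $\gamma:V\to 2^\Gamma$, and a positive Boolean formula $\varphi$ over atoms $\mathsf{GF}\,a,\mathsf{FG}\,a,\mathsf{F}\,a,\mathsf{G}\,a$; a play $v_0v_1\ldots$ satisfies $\mathsf{F}\,a$ iff $a\in\gamma(v_j)$ for some $j$, $\mathsf{G}\,a$ iff for all $j$, $\mathsf{GF}\,a$ iff for infinitely many $j$, $\mathsf{FG}\,a$ iff for all but finitely many $j$. An Emerson-Lei (EL) objective is an MP objective using only $\mathsf{GF},\mathsf{FG}$ atoms. The system player wins a node $v$ if it has a strategy such that every compatible play starting at $v$ satisfies $\varphi$. -}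

module Defs where

open import Data.Nat using (ℕ; zero; suc; _≤_)
open import Data.Fin using (Fin)
open import Data.Fin.Subset using (Subset; _∈_; _⊆_; _∪_; _∩_; ⁅_⁆; ⊥)
open import Data.Fin.Subset.Properties using (_⊆?_; q⊆p∪q)
open import Data.Bool using (Bool; true; false; T)
open import Data.List using (List; []; _∷_; map; upTo)
open import Data.Product using (Σ; ∃; _×_; _,_; proj₁)
open import Data.Sum using (_⊎_)
open import Data.Unit using (⊤)
open import Data.Empty renaming (⊥ to Empty)
open import Relation.Nullary.Decidable using (⌊_⌋; fromWitness)
open import Relation.Binary.PropositionalEquality using (_≡_)

-- Game arenas (over an arbitrary node type; finiteness imposed where used)

record Arena : Set₁ where
  field
    Node : Set
    Edge : Node → Node → Set      -- Edge u w : w ∈ E(u)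
    sys  : Node → Bool            -- true = system node, false = environment node

open Arena public

Total : Arena → Set
Total A = ∀ v → Σ (Node A) (Edge A v)

IsPlay : (A : Arena) → (ℕ → Node A) → Set
IsPlay A p = ∀ i → Edge A (p i) (p (suc i))

-- A system strategy: maps a finite play (history of earlier nodes,
-- followed by the current node v, which is a system node) to a successor of v.
Strategy : Arena → Set
Strategy A = List (Node A) → (v : Node A) → sys A v ≡ true → Σ (Node A) (Edge A v)

-- the nodes p 0, …, p (i-1)
prefix : {X : Set} → (ℕ → X) → ℕ → List X
prefix p i = map p (upTo i)

Compatible : (A : Arena) → Strategy A → (ℕ → Node A) → Set
Compatible A σ p =
  ∀ i → (s : sys A (p i) ≡ true) → p (suc i) ≡ proj₁ (σ (prefix p i) (p i) s)

data Atom (k : ℕ) : Set where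
  GF FG F G : Fin k → Atom k

data Formula (k : ℕ) : Set where
  tt ff : Formula k
  atom  : Atom k → Formula k
  _∧_ _∨_ : Formula k → Formula k → Formula k

event : ∀ {k} → Atom k → Fin k
event (GF a) = a
event (FG a) = a
event (F a)  = a
event (G a)  = a

module _ {V : Set} {k : ℕ} (γ : V → Subset k) (p : ℕ → V) where

  SatAtom : Atom k → Set
  SatAtom (GF a) = ∀ i → ∃ λ j → i ≤ j × a ∈ γ (p j)
  SatAtom (FG a) = ∃ λ i → ∀ j → i ≤ j → a ∈ γ (p j)
  SatAtom (F a)  = ∃ λ j → a ∈ γ (p j)
  SatAtom (G a)  = ∀ j → a ∈ γ (p j)

  Sat : Formula k → Set
  Sat tt       = ⊤
  Sat ff       = Empty
  Sat (atom x) = SatAtom x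
  Sat (φ ∧ ψ)  = Sat φ × Sat ψ
  Sat (φ ∨ ψ)  = Sat φ ⊎ Sat ψ

Wins : (A : Arena) {k : ℕ} → (Node A → Subset k) → Formula k → Node A → Set
Wins A γ φ v =
  Σ (Strategy A) λ σ →
    ∀ (p : ℕ → Node A) → p 0 ≡ v → IsPlay A p → Compatible A σ p → Sat γ p φ

data _occursIn_ {k : ℕ} (x : Atom k) : Formula k → Set where
  here  : x occursIn atom x
  ∧ˡ    : ∀ {φ ψ} → x occursIn φ → x occursIn (φ ∧ ψ)
  ∧ʳ    : ∀ {φ ψ} → x occursIn ψ → x occursIn (φ ∧ ψ)
  ∨ˡ    : ∀ {φ ψ} → x occursIn φ → x occursIn (φ ∨ ψ)
  ∨ʳ    : ∀ {φ ψ} → x occursIn ψ → x occursIn (φ ∨ ψ)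

EventsInUniqueAtoms : ∀ {k} → Formula k → Set
EventsInUniqueAtoms φ =
  ∀ x y → x occursIn φ → y occursIn φ → event x ≡ event y → x ≡ y

module _ {k : ℕ} where

  atomEvents : (Atom k → Bool) → Formula k → Subset k
  atomEvents P tt       = ⊥
  atomEvents P ff       = ⊥
  atomEvents P (atom x) with P x
  ... | true  = ⁅ event x ⁆
  ... | false = ⊥
  atomEvents P (φ ∧ ψ)  = atomEvents P φ ∪ atomEvents P ψ
  atomEvents P (φ ∨ ψ)  = atomEvents P φ ∪ atomEvents P ψ

  isF isG isEL : Atom k → Bool
  isF (F _) = true
  isF _     = false
  isG (G _) = true
  isG _     = false
  isEL (GF _) = true
  isEL (FG _) = true
  isEL _      = false

  ΓF ΓG ΓFG ΓEL : Formula k → Subset k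
  ΓF  = atomEvents isF
  ΓG  = atomEvents isG
  ΓFG φ = ΓF φ ∪ ΓG φ
  ΓEL = atomEvents isEL

  toGF : Atom k → Atom k
  toGF (F a) = GF a
  toGF (G a) = GF a
  toGF x     = x

  φ₁ : Formula k → Formula k
  φ₁ tt       = tt
  φ₁ ff       = ff
  φ₁ (atom x) = atom (toGF x)
  φ₁ (φ ∧ ψ)  = φ₁ φ ∧ φ₁ ψ
  φ₁ (φ ∨ ψ)  = φ₁ φ ∨ φ₁ ψ

-- subsets L ⊆ Γ_{F,G}  (the membership proof is T of a Boolean, hence unique)
SubsetOf : ∀ {k} → Subset k → Set
SubsetOf {k} S = Σ (Subset k) λ L → T ⌊ L ⊆? S ⌋

module Reduction {k : ℕ} (A : Arena) (γ : Node A → Subset k) (φ : Formula k) where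

  upd : Node A → Subset k → Subset k
  upd v L = ((L ∩ γ v) ∩ ΓG φ) ∪ ((L ∪ γ v) ∩ ΓF φ)

  A' : Arena
  A' = record
    { Node = Node A × SubsetOf (ΓFG φ)
    ; Edge = λ { (v , L , _) (w , L' , _) → Edge A v w × (L' ≡ upd v L) }
    ; sys  = λ { (v , _) → sys A v }
    }

  γ' : Node A' → Subset k
  γ' (v , L , _) = (γ v ∩ ΓEL φ) ∪ L

  ΓG⊆ΓFG : T ⌊ ΓG φ ⊆? ΓFG φ ⌋
  ΓG⊆ΓFG = fromWitness (λ {x} → q⊆p∪q (ΓF φ) (ΓG φ) {x})

  init : Node A → Node A'
  init v = v , ΓG φ , ΓG⊆ΓFG

finArena : (n : ℕ) → (Fin n → Fin n → Bool) → (Fin n → Bool) → Arena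
finArena n e s = record { Node = Fin n ; Edge = λ u w → T (e u w) ; sys = s }

{-# OPTIONS --safe #-}
-- The second component of a node of A', its monitor, is determined by the history of the play: from
-- Γ_G on, upd keeps a G-event while it keeps occurring and adds an F-event once it has occurred.
-- So plays from v in A and from (v, Γ_G) in A' correspond one to one, and strategies transfer
-- along this correspondence by forgetting, resp. recomputing, the second component. On
-- corresponding plays, G a holds iff a stays in the monitor forever, iff it is in it infinitely
-- often (once a G-event leaves it never returns); F a holds iff a enters the monitor, iff it is
-- in it infinitely often (an F-event never leaves). Since every event occurs in only one atom,
-- γ' shows exactly the monitor on F- and G-events and exactly γ on the Emerson-Lei events.
module Submission where

open import Defs
open import Data.Nat using (ℕ; zero; suc; _≤_; _+_; _≤′_; ≤′-refl; ≤′-step)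
open import Data.Nat.Properties using (≤-refl; m≤m+n; m≤n+m; ≤⇒≤′)
open import Data.Fin using (Fin)
open import Data.Fin.Subset using (Subset; _∈_; _∉_; _⊆_)
open import Data.Fin.Subset.Properties
  using (x∈p∩q⁺; x∈p∩q⁻; x∈p∪q⁺; x∈p∪q⁻; p⊆p∪q; q⊆p∪q; ∉⊥; x∈⁅x⁆; x∈⁅y⁆⇒x≡y; _⊆?_)
open import Data.Bool using (Bool; true; false)
open import Data.Bool.Properties using (T-irrelevant)
open import Data.List using (List; []; _∷_; map; foldl; upTo; _∷ʳ_)
open import Data.List.Properties using (upTo-∷ʳ; map-++; map-∘; foldl-∷ʳ)
open import Data.Product using (Σ; ∃; _×_; _,_; proj₁; proj₂; map₁; map₂)
open import Data.Product.Function.NonDependent.Propositional using (_×-⇔_)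
open import Data.Sum using (_⊎_; inj₁; inj₂; [_,_]′)
open import Data.Sum.Function.Propositional using (_⊎-⇔_)
open import Data.Empty using (⊥-elim)
open import Relation.Nullary using (¬_)
open import Relation.Nullary.Decidable using (fromWitness; toWitness)
open import Relation.Binary.PropositionalEquality
  using (_≡_; refl; sym; trans; cong; cong₂; subst; module ≡-Reasoning)
open import Function using (_∘_)
open import Function.Bundles using (_⇔_; mk⇔; Equivalence)
import Function.Properties.Equivalence as ⇔

open Equivalence

InfinitelyOften : (ℕ → Set) → Set
InfinitelyOften P = ∀ i → ∃ λ j → i ≤ j × P j

InfinitelyOften-cong : {P Q : ℕ → Set} → (∀ j → P j ⇔ Q j) →
                       InfinitelyOften P ⇔ InfinitelyOften Q
InfinitelyOften-cong P⇔Q = mk⇔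
  (λ io i → map₂ (map₂ (to   (P⇔Q _))) (io i))
  (λ io i → map₂ (map₂ (from (P⇔Q _))) (io i))

module _ {P : ℕ → Set} where

  antitone : (∀ j → P (suc j) → P j) → ∀ {i j} → i ≤ j → P j → P i
  antitone down = go ∘ ≤⇒≤′
    where
    go : ∀ {i j} → i ≤′ j → P j → P i
    go ≤′-refl        = λ Pj → Pj
    go (≤′-step i≤′j) = go i≤′j ∘ down _

  monotone : (∀ j → P j → P (suc j)) → ∀ {i j} → i ≤ j → P i → P j
  monotone up = go ∘ ≤⇒≤′
    where
    go : ∀ {i j} → i ≤′ j → P i → P j
    go ≤′-refl        = λ Pi → Pi
    go (≤′-step i≤′j) = up _ ∘ go i≤′j

module _ {P H : ℕ → Set} where

  always⇔infinitelyOften-heldSoFar :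
    H 0 → (∀ j → H (suc j) ⇔ (H j × P j)) → (∀ j → P j) ⇔ InfinitelyOften H
  always⇔infinitelyOften-heldSoFar H₀ step = mk⇔
      (λ always i → i , ≤-refl , held always i)
      (λ io j → let (m , j<m , Hm) = io (suc j)
                in proj₂ (to (step j) (antitone (λ i → proj₁ ∘ to (step i)) j<m Hm)))
    where
    held : (∀ j → P j) → ∀ j → H j
    held always zero    = H₀
    held always (suc j) = from (step j) (held always j , always j)

  eventually⇔infinitelyOften-seenSoFar :
    ¬ H 0 → (∀ j → H (suc j) ⇔ (H j ⊎ P j)) → (∃ λ j → P j) ⇔ InfinitelyOften H
  eventually⇔infinitelyOften-seenSoFar ¬H₀ step = mk⇔
      (λ (j , Pj) i → i + suc j , m≤m+n i (suc j) ,
         monotone (λ m → from (step m) ∘ inj₁) (m≤n+m (suc j) i) (from (step j) (inj₂ Pj)))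
      (λ io → witness _ (proj₂ (proj₂ (io 0))))
    where
    witness : ∀ m → H m → ∃ λ j → P j
    witness zero    H₀ = ⊥-elim (¬H₀ H₀)
    witness (suc m) Hm = [ witness m , (m ,_) ]′ (to (step m) Hm)

module _ {k : ℕ} where

  ∈-atomEvents⁺ : (P : Atom k → Bool) {x : Atom k} {φ : Formula k} →
                  x occursIn φ → P x ≡ true → event x ∈ atomEvents P φ
  ∈-atomEvents⁺ P {x} here Px rewrite Px = x∈⁅x⁆ (event x)
  ∈-atomEvents⁺ P {φ = _ ∧ ψ} (∧ˡ o) Px = p⊆p∪q (atomEvents P ψ) (∈-atomEvents⁺ P o Px)
  ∈-atomEvents⁺ P {φ = φ ∧ _} (∧ʳ o) Px = q⊆p∪q (atomEvents P φ) _ (∈-atomEvents⁺ P o Px)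
  ∈-atomEvents⁺ P {φ = _ ∨ ψ} (∨ˡ o) Px = p⊆p∪q (atomEvents P ψ) (∈-atomEvents⁺ P o Px)
  ∈-atomEvents⁺ P {φ = φ ∨ _} (∨ʳ o) Px = q⊆p∪q (atomEvents P φ) _ (∈-atomEvents⁺ P o Px)

  ∈-atomEvents⁻ : (P : Atom k → Bool) (φ : Formula k) {a : Fin k} → a ∈ atomEvents P φ →
                  ∃ λ x → x occursIn φ × P x ≡ true × event x ≡ a
  ∈-atomEvents⁻ P tt       a∈ = ⊥-elim (∉⊥ a∈)
  ∈-atomEvents⁻ P ff       a∈ = ⊥-elim (∉⊥ a∈)
  ∈-atomEvents⁻ P (atom x) a∈ with P x in Px
  ... | true  = x , here , Px , sym (x∈⁅y⁆⇒x≡y (event x) a∈)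
  ... | false = ⊥-elim (∉⊥ a∈)
  ∈-atomEvents⁻ P (φ ∧ ψ)  a∈ = [ map₂ (map₁ ∧ˡ) ∘ ∈-atomEvents⁻ P φ
                                , map₂ (map₁ ∧ʳ) ∘ ∈-atomEvents⁻ P ψ ]′ (x∈p∪q⁻ _ _ a∈)
  ∈-atomEvents⁻ P (φ ∨ ψ)  a∈ = [ map₂ (map₁ ∨ˡ) ∘ ∈-atomEvents⁻ P φ
                                , map₂ (map₁ ∨ʳ) ∘ ∈-atomEvents⁻ P ψ ]′ (x∈p∪q⁻ _ _ a∈)

  ∉-atomEvents : {φ : Formula k} → EventsInUniqueAtoms φ →
                 (P : Atom k → Bool) {x : Atom k} → x occursIn φ → P x ≡ false →
                 event x ∉ atomEvents P φ
  ∉-atomEvents {φ} unique P {x} x∈φ Px≡false ev∈ with ∈-atomEvents⁻ P φ ev∈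
  ... | y , y∈φ , Py≡true , ey≡ex with unique y x y∈φ x∈φ ey≡ex
  ... | refl with trans (sym Py≡true) Px≡false
  ... | ()

module _ {V V′ : Set} {k : ℕ} {γ : V → Subset k} {γ′ : V′ → Subset k}
         {p : ℕ → V} {p′ : ℕ → V′} where

  SatAtom-cong : (x : Atom k) → (∀ j → event x ∈ γ (p j) ⇔ event x ∈ γ′ (p′ j)) →
                 SatAtom γ p x ⇔ SatAtom γ′ p′ x
  SatAtom-cong (GF a) same = InfinitelyOften-cong same
  SatAtom-cong (FG a) same = mk⇔
    (λ (i , h) → i , λ j i≤j → to   (same j) (h j i≤j))
    (λ (i , h) → i , λ j i≤j → from (same j) (h j i≤j))
  SatAtom-cong (F a)  same = mk⇔ (λ (j , h) → j , to (same j) h) (λ (j , h) → j , from (same j) h)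
  SatAtom-cong (G a)  same = mk⇔ (λ h j → to (same j) (h j)) (λ h j → from (same j) (h j))

  Sat-φ₁ : (ψ : Formula k) →
           (∀ x → x occursIn ψ → SatAtom γ p x ⇔ SatAtom γ′ p′ (toGF x)) →
           Sat γ p ψ ⇔ Sat γ′ p′ (φ₁ ψ)
  Sat-φ₁ tt       atoms = ⇔.refl
  Sat-φ₁ ff       atoms = ⇔.refl
  Sat-φ₁ (atom x) atoms = atoms x here
  Sat-φ₁ (ψ ∧ χ)  atoms = Sat-φ₁ ψ (λ x → atoms x ∘ ∧ˡ) ×-⇔ Sat-φ₁ χ (λ x → atoms x ∘ ∧ʳ)
  Sat-φ₁ (ψ ∨ χ)  atoms = Sat-φ₁ ψ (λ x → atoms x ∘ ∨ˡ) ⊎-⇔ Sat-φ₁ χ (λ x → atoms x ∘ ∨ʳ)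

SubsetOf-≡ : {k : ℕ} {S : Subset k} {X Y : SubsetOf S} → proj₁ X ≡ proj₁ Y → X ≡ Y
SubsetOf-≡ {X = L , L⊆S} {.L , L⊆S′} refl = cong (L ,_) (T-irrelevant L⊆S L⊆S′)

prefix-suc : {X : Set} (f : ℕ → X) (i : ℕ) → prefix f (suc i) ≡ prefix f i ∷ʳ f i
prefix-suc f i = trans (cong (map f) (sym (upTo-∷ʳ i))) (map-++ f (upTo i) (i ∷ []))

module ReductionCorrect {k : ℕ} (A : Arena) (γ : Node A → Subset k) (φ : Formula k) where

  open Reduction A γ φ

  monitor : Node A' → Subset k
  monitor (_ , L , _) = L

  module _ {a : Fin k} where

    ∈-upd-G : a ∈ ΓG φ → a ∉ ΓF φ → ∀ v L → a ∈ upd v L ⇔ (a ∈ L × a ∈ γ v)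
    ∈-upd-G inG ∉F v L = mk⇔
      (λ a∈ → [ x∈p∩q⁻ L (γ v) ∘ proj₁ ∘ x∈p∩q⁻ _ _
              , ⊥-elim ∘ ∉F ∘ proj₂ ∘ x∈p∩q⁻ _ _ ]′ (x∈p∪q⁻ _ _ a∈))
      (λ a∈L×γv → x∈p∪q⁺ (inj₁ (x∈p∩q⁺ (x∈p∩q⁺ a∈L×γv , inG))))

    ∈-upd-F : a ∈ ΓF φ → a ∉ ΓG φ → ∀ v L → a ∈ upd v L ⇔ (a ∈ L ⊎ a ∈ γ v)
    ∈-upd-F inF ∉G v L = mk⇔
      (λ a∈ → [ ⊥-elim ∘ ∉G ∘ proj₂ ∘ x∈p∩q⁻ _ _
              , x∈p∪q⁻ L (γ v) ∘ proj₁ ∘ x∈p∩q⁻ _ _ ]′ (x∈p∪q⁻ _ _ a∈))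
      (λ a∈L⊎γv → x∈p∪q⁺ (inj₂ (x∈p∩q⁺ (x∈p∪q⁺ a∈L⊎γv , inF))))

    ∈-γ'-EL : a ∈ ΓEL φ → a ∉ ΓF φ → a ∉ ΓG φ → ∀ u → a ∈ γ' u ⇔ a ∈ γ (proj₁ u)
    ∈-γ'-EL inEL ∉F ∉G (v , L , L⊆ΓFG) = mk⇔
      (λ a∈ → [ proj₁ ∘ x∈p∩q⁻ _ _
              , ⊥-elim ∘ [ ∉F , ∉G ]′ ∘ x∈p∪q⁻ _ _ ∘ toWitness L⊆ΓFG ]′ (x∈p∪q⁻ _ _ a∈))
      (λ a∈γv → x∈p∪q⁺ (inj₁ (x∈p∩q⁺ (a∈γv , inEL))))

    ∈-γ'-FG : a ∉ ΓEL φ → ∀ u → a ∈ γ' u ⇔ a ∈ monitor u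
    ∈-γ'-FG ∉EL (v , L , _) = mk⇔
      (λ a∈ → [ ⊥-elim ∘ ∉EL ∘ proj₂ ∘ x∈p∩q⁻ _ _ , (λ a∈L → a∈L) ]′ (x∈p∪q⁻ _ _ a∈))
      (λ a∈L → x∈p∪q⁺ (inj₂ a∈L))

  Monitored : (ℕ → Node A') → Set
  Monitored p′ = monitor (p′ 0) ≡ ΓG φ
               × ∀ j → monitor (p′ (suc j)) ≡ upd (proj₁ (p′ j)) (monitor (p′ j))

  module _ (unique : EventsInUniqueAtoms φ) (p′ : ℕ → Node A') (monitored : Monitored p′) where

    private
      q : ℕ → Node A
      q = proj₁ ∘ p′

      ∉-kind : (P : Atom k → Bool) {x : Atom k} → x occursIn φ → P x ≡ false →
               event x ∉ atomEvents P φ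
      ∉-kind = ∉-atomEvents unique

      EL-atom : ∀ x → x occursIn φ → isEL x ≡ true → isF x ≡ false → isG x ≡ false →
                SatAtom γ q x ⇔ SatAtom γ' p′ x
      EL-atom x x∈φ el ¬f ¬g = SatAtom-cong {γ = γ} {γ′ = γ'} {p = q} {p′ = p′} x λ j →
        ⇔.sym (∈-γ'-EL (∈-atomEvents⁺ isEL x∈φ el) (∉-kind isF x∈φ ¬f) (∉-kind isG x∈φ ¬g) (p′ j))

      ∈-monitor⇔∈-γ' : ∀ {x} → x occursIn φ → isEL x ≡ false →
                       ∀ j → event x ∈ monitor (p′ j) ⇔ event x ∈ γ' (p′ j)
      ∈-monitor⇔∈-γ' x∈φ ¬el j = ⇔.sym (∈-γ'-FG (∉-kind isEL x∈φ ¬el) (p′ j))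

      ∈-monitor-suc : ∀ {a} j → a ∈ monitor (p′ (suc j)) ⇔ a ∈ upd (q j) (monitor (p′ j))
      ∈-monitor-suc {a} j =
        subst (λ L → a ∈ monitor (p′ (suc j)) ⇔ a ∈ L) (proj₂ monitored j) ⇔.refl

    SatAtom-reduction : ∀ x → x occursIn φ → SatAtom γ q x ⇔ SatAtom γ' p′ (toGF x)
    SatAtom-reduction (GF a) x∈φ = EL-atom (GF a) x∈φ refl refl refl
    SatAtom-reduction (FG a) x∈φ = EL-atom (FG a) x∈φ refl refl refl
    SatAtom-reduction (F a)  x∈φ = ⇔.trans
      (eventually⇔infinitelyOften-seenSoFar (∉G ∘ subst (a ∈_) (proj₁ monitored)) λ j →
        ⇔.trans (∈-monitor-suc j) (∈-upd-F (∈-atomEvents⁺ isF x∈φ refl) ∉G _ _))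
      (InfinitelyOften-cong (∈-monitor⇔∈-γ' x∈φ refl))
      where
      ∉G : a ∉ ΓG φ
      ∉G = ∉-kind isG x∈φ refl
    SatAtom-reduction (G a)  x∈φ = ⇔.trans
      (always⇔infinitelyOften-heldSoFar (subst (a ∈_) (sym (proj₁ monitored)) inG) λ j →
        ⇔.trans (∈-monitor-suc j) (∈-upd-G inG (∉-kind isF x∈φ refl) _ _))
      (InfinitelyOften-cong (∈-monitor⇔∈-γ' x∈φ refl))
      where
      inG : a ∈ ΓG φ
      inG = ∈-atomEvents⁺ isG x∈φ refl

    Sat-reduction : Sat γ q φ ⇔ Sat γ' p′ (φ₁ φ)
    Sat-reduction = Sat-φ₁ φ SatAtom-reduction

  play-monitored : ∀ {v} p′ → p′ 0 ≡ init v → IsPlay A' p′ → Monitored p′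
  play-monitored p′ p′₀ play = cong monitor p′₀ , proj₂ ∘ play

  upd′ : Node A → SubsetOf (ΓFG φ) → SubsetOf (ΓFG φ)
  upd′ v (L , _) = upd v L , fromWitness {a? = upd v L ⊆? ΓFG φ} upd⊆ΓFG
    where
    upd⊆ΓFG : upd v L ⊆ ΓFG φ
    upd⊆ΓFG = [ q⊆p∪q (ΓF φ) _ ∘ proj₂ ∘ x∈p∩q⁻ _ _
              , p⊆p∪q (ΓG φ) ∘ proj₂ ∘ x∈p∩q⁻ _ _ ]′ ∘ x∈p∪q⁻ _ _

  liftStrategy : Strategy A → Strategy A'
  liftStrategy σ hist (u , L) u∈Vs =
    let (w , u→w) = σ (map proj₁ hist) u u∈Vs in (w , upd′ u L) , u→w , refl

  project-compatible : ∀ σ {p′} → Compatible A' (liftStrategy σ) p′ →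
                       Compatible A σ (proj₁ ∘ p′)
  project-compatible σ compatible i u∈Vs =
    trans (cong proj₁ (compatible i u∈Vs))
          (cong (λ hist → proj₁ (σ hist _ u∈Vs)) (sym (map-∘ (upTo i))))

  wins⁺ : EventsInUniqueAtoms φ → ∀ {v} → Wins A γ φ v → Wins A' γ' (φ₁ φ) (init v)
  wins⁺ unique (σ , winning) = liftStrategy σ , λ p′ p′₀ play compatible →
    to (Sat-reduction unique p′ (play-monitored p′ p′₀ play))
       (winning (proj₁ ∘ p′) (cong proj₁ p′₀) (proj₁ ∘ play) (project-compatible σ compatible))

  run : SubsetOf (ΓFG φ) → List (Node A) → SubsetOf (ΓFG φ)
  run = foldl (λ L u → upd′ u L)

  annotate : SubsetOf (ΓFG φ) → List (Node A) → List (Node A')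
  annotate L []       = []
  annotate L (u ∷ us) = (u , L) ∷ annotate (upd′ u L) us

  annotate-∷ʳ : ∀ L us u → annotate L (us ∷ʳ u) ≡ annotate L us ∷ʳ (u , run L us)
  annotate-∷ʳ L []        u = refl
  annotate-∷ʳ L (u′ ∷ us) u = cong ((u′ , L) ∷_) (annotate-∷ʳ (upd′ u′ L) us u)

  initMonitor : SubsetOf (ΓFG φ)
  initMonitor = ΓG φ , ΓG⊆ΓFG

  projectStrategy : Strategy A' → Strategy A
  projectStrategy σ′ hist u u∈Vs =
    let ((w , _) , u→w , _) = σ′ (annotate initMonitor hist) (u , run initMonitor hist) u∈Vs
    in  w , u→w

  annotatePlay : (ℕ → Node A) → ℕ → Node A'
  annotatePlay p j = p j , run initMonitor (prefix p j)

  run-prefix-suc : ∀ p j →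
                   run initMonitor (prefix p (suc j)) ≡ upd′ (p j) (run initMonitor (prefix p j))
  run-prefix-suc p j =
    trans (cong (run initMonitor) (prefix-suc p j)) (foldl-∷ʳ _ initMonitor (p j) (prefix p j))

  prefix-annotatePlay : ∀ p i → prefix (annotatePlay p) i ≡ annotate initMonitor (prefix p i)
  prefix-annotatePlay p zero    = refl
  prefix-annotatePlay p (suc i) = begin
    prefix (annotatePlay p) (suc i)
      ≡⟨ prefix-suc (annotatePlay p) i ⟩
    prefix (annotatePlay p) i ∷ʳ annotatePlay p i
      ≡⟨ cong (_∷ʳ annotatePlay p i) (prefix-annotatePlay p i) ⟩
    annotate initMonitor (prefix p i) ∷ʳ annotatePlay p i
      ≡⟨ annotate-∷ʳ initMonitor (prefix p i) (p i) ⟨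
    annotate initMonitor (prefix p i ∷ʳ p i)
      ≡⟨ cong (annotate initMonitor) (prefix-suc p i) ⟨
    annotate initMonitor (prefix p (suc i))
      ∎
    where open ≡-Reasoning

  annotatePlay-monitored : ∀ p → Monitored (annotatePlay p)
  annotatePlay-monitored p = refl , cong proj₁ ∘ run-prefix-suc p

  annotatePlay-isPlay : ∀ {p} → IsPlay A p → IsPlay A' (annotatePlay p)
  annotatePlay-isPlay {p} play j = play j , proj₂ (annotatePlay-monitored p) j

  annotatePlay-compatible : ∀ σ′ p → Compatible A (projectStrategy σ′) p →
                            Compatible A' σ′ (annotatePlay p)
  annotatePlay-compatible σ′ p compatible i u∈Vs =
    subst (λ hist → annotatePlay p (suc i) ≡ proj₁ (σ′ hist (annotatePlay p i) u∈Vs))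
          (sym (prefix-annotatePlay p i))
          (cong₂ _,_ (compatible i u∈Vs) (SubsetOf-≡ (trans (proj₂ (annotatePlay-monitored p) i)
                                                            (sym (proj₂ (proj₂ move))))))
    where
    move : Σ (Node A') (Edge A' (annotatePlay p i))
    move = σ′ (annotate initMonitor (prefix p i)) (annotatePlay p i) u∈Vs

  wins⁻ : EventsInUniqueAtoms φ → ∀ {v} → Wins A' γ' (φ₁ φ) (init v) → Wins A γ φ v
  wins⁻ unique (σ′ , winning) = projectStrategy σ′ , λ p p₀ play compatible →
    from (Sat-reduction unique (annotatePlay p) (annotatePlay-monitored p))
         (winning (annotatePlay p) (cong (_, initMonitor) p₀) (annotatePlay-isPlay play)
                  (annotatePlay-compatible σ′ p compatible))

  wins⇔ : EventsInUniqueAtoms φ → ∀ v → Wins A γ φ v ⇔ Wins A' γ' (φ₁ φ) (init v)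
  wins⇔ unique v = mk⇔ (wins⁺ unique) (wins⁻ unique)

lemma3 : (n k : ℕ) → k ≤ n →
         (e : Fin n → Fin n → Bool) (s : Fin n → Bool) →
         Total (finArena n e s) →
         (γ : Fin n → Subset k) (φ : Formula k) →
         EventsInUniqueAtoms φ →
         (v : Fin n) →
         Wins (finArena n e s) γ φ v
           ⇔ Wins (Reduction.A' (finArena n e s) γ φ) (Reduction.γ' (finArena n e s) γ φ)
                  (φ₁ φ) (Reduction.init (finArena n e s) γ φ v)
lemma3 n k _ e s _ γ φ = ReductionCorrect.wins⇔ (finArena n e s) γ φ
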